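{- If $L$ is a finite lattice of nullity $k \geq 1$, then $2 \leq |Red(L)| \leq 2k$.
   Context: For a finite poset $P$, the cover graph $C(P)$ is the graph on $P$ whose edges are the covering pairs $a \prec b$. The nullity $\eta(P)$ of $P$ is the nullity of its cover graph, i.e. $m - n + c$ where $m$ is the number of edges, $n$ the number of vertices and $c$ the number of connected components of $C(P)$. An element $x$ of a lattice $L$ is join-reducible (meet-reducible) if $x = y \vee z$ ($x = y \wedge z$) for some $y,z \in L$ both distinct from $x$; $x$ is reducible if it is join-reducible or meet-reducible. $Red(L)$ denotes the set of reducible elements of $L$. -}

module Defs where

open import Level using (0ℓ)
open import Data.Nat using (ℕ)
open import Data.Fin as Fin using (Fin)
import Data.Sum
open import Data.Product using (Σ; ∃; _×_; _,_)
open import Relation.Nullary using (¬_)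
open import Relation.Binary.PropositionalEquality using (_≡_; _≢_)
open import Relation.Binary.Core using (Rel)
open import Relation.Binary.Construct.Closure.Equivalence using (EqClosure)
open import Function.Definitions using (Injective)
open import Function.Bundles using (_⇔_)

HasCard : {A : Set} → (A → Set) → ℕ → Set
HasCard {A} P k =
  Σ (Fin k → A) λ f → Injective _≡_ _≡_ f × (∀ x → P x ⇔ ∃ λ i → f i ≡ x)

module Poset {n : ℕ} (_≤_ : Rel (Fin n) 0ℓ) where

  _<_ : Rel (Fin n) 0ℓ
  a < b = a ≤ b × a ≢ b

  _⋖_ : Rel (Fin n) 0ℓ
  a ⋖ b = a < b × (∀ c → ¬ (a < c × c < b))

  -- edges of the cover graph (each covering pair counted once, as (a , b) with a ⋖ b)
  CoverEdge : Fin n × Fin n → Set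
  CoverEdge (a , b) = a ⋖ b

  Connected : Rel (Fin n) 0ℓ
  Connected = EqClosure _⋖_

  -- one representative per connected component: its least vertex (in Fin order)
  ComponentRep : Fin n → Set
  ComponentRep i = ∀ j → Connected i j → i Fin.≤ j

  -- η(P) = k  iff  m - n + c = k, with m = #edges, c = #components
  HasNullity : ℕ → Set
  HasNullity k = ∃ λ m → ∃ λ c → HasCard CoverEdge m × HasCard ComponentRep c ×
                 m Data.Nat.+ c ≡ n Data.Nat.+ k

module LatticeOps {n : ℕ} (_∨_ _∧_ : Fin n → Fin n → Fin n) where

  JoinReducible : Fin n → Set
  JoinReducible x = ∃ λ y → ∃ λ z → y ≢ x × z ≢ x × x ≡ y ∨ z

  MeetReducible : Fin n → Set
  MeetReducible x = ∃ λ y → ∃ λ z → y ≢ x × z ≢ x × x ≡ y ∧ z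

  Reducible : Fin n → Set
  Reducible x = Data.Sum._⊎_ (JoinReducible x) (MeetReducible x)

-- Counting each covering pair a ⋖ b at its lower end gives m = Σₐ #(upper covers of a).
-- In a finite lattice every a ≠ ⊤ has an upper cover, and a is meet-reducible iff it has
-- at least two, so n − 1 + #MeetReducible ≤ m. The cover graph of a lattice is connected,
-- hence m = n − 1 + k and #MeetReducible ≤ k; dually #JoinReducible ≤ k. If k ≥ 1 then
-- m ≥ n, so some element has two upper covers and is meet-reducible, a = y ∧ z; then y ∨ z
-- is join-reducible and different from a.

module Submission where

open import Defs
open import Level using (0ℓ)
open import Algebra.Core using (Op₂)
import Algebra.Properties.CommutativeSemigroup as CommutativeSemigroupProperties
open import Data.Bool using (true; false)
open import Data.Empty using (⊥-elim)
open import Data.Fin using (Fin; zero)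
open import Data.Fin.Induction using (po-wellFounded; po-noetherian)
open import Data.Fin.Properties using (_≟_; any?; all?)
import Data.Fin.Properties as Fin
open import Data.List using (List; []; _∷_; _++_; length; map; filter; allFin; foldr; cartesianProduct)
open import Data.List.Membership.Propositional using (_∈_)
open import Data.List.Membership.Propositional.Properties
  using (∈-map⁺; ∈-map⁻; ∈-filter⁺; ∈-filter⁻; ∈-allFin; ∈-cartesianProduct⁺; ∈-++⁺ˡ; ∈-++⁺ʳ)
open import Data.List.Properties using (filter-notAll; filter-none; filter-++; length-++; length-map; length-tabulate)
open import Data.List.Relation.Binary.Subset.Propositional using (_⊆_)
import Data.List.Relation.Unary.All as All
import Data.List.Relation.Unary.Any as Any
open import Data.List.Relation.Unary.Any using (here; there)
open import Data.List.Relation.Unary.AllPairs using ([]; _∷_)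
open import Data.List.Relation.Unary.Unique.Propositional using (Unique)
open import Data.List.Relation.Unary.Unique.Propositional.Properties using (map⁺; filter⁺; allFin⁺; cartesianProduct⁺)
open import Data.Nat using (ℕ; suc; _≤_; _+_; _*_; z≤n; s≤s)
open import Data.Nat.ListAction using (sum)
open import Data.Nat.Properties
  using (≤-antisym; ≤-reflexive; +-mono-≤; +-cancelˡ-≤; +-identityʳ; m≤n+m; m<m+n; <-irrefl;
         +-commutativeSemigroup; module ≤-Reasoning)
open import Data.Product using (_×_; _,_; proj₁; proj₂; ∃; ∃₂; swap)
open import Data.Product.Properties using (≡-dec)
open import Data.Sum using (inj₁; inj₂)
open import Function.Base using (_∘_; flip)
open import Function.Bundles using (_⇔_; mk⇔; Equivalence)
open import Induction.WellFounded using (Acc; acc)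
open import Relation.Binary.Core using (Rel)
open import Relation.Binary.Definitions using (DecidableEquality)
open import Relation.Binary.Lattice using (Lattice; IsLattice)
import Relation.Binary.Lattice.Properties.JoinSemilattice as JoinSemilatticeProperties
import Relation.Binary.Lattice.Properties.Lattice as LatticeProperties
open import Relation.Binary.Structures using (IsPartialOrder)
import Relation.Binary.Construct.NonStrictToStrict as ToStrict
open import Relation.Binary.Construct.Closure.Equivalence using (symmetric; transitive)
open import Relation.Binary.Construct.Closure.ReflexiveTransitive using (ε; _◅_)
open import Relation.Binary.Construct.Closure.Symmetric using (fwd)
open import Relation.Binary.PropositionalEquality using (_≡_; _≢_; refl; sym; trans; cong; cong₂; subst)
open import Relation.Nullary using (Dec; yes; no; does; ¬_; ¬?)
open import Relation.Nullary.Decidable using (_×-dec_)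
open import Relation.Unary using (Decidable)

iverson : {P : Set} → Dec P → ℕ
iverson (yes _) = 1
iverson (no _)  = 0

count : {A : Set} {P : A → Set} → Decidable P → List A → ℕ
count P? xs = length (filter P? xs)

module _ {A : Set} where

  Unique-allEqual⇒length≤1 : {xs : List A} → Unique xs → (∀ {y z} → y ∈ xs → z ∈ xs → y ≡ z) →
                             length xs ≤ 1
  Unique-allEqual⇒length≤1 {[]}         _                    _     = z≤n
  Unique-allEqual⇒length≤1 {_ ∷ []}     _                    _     = s≤s z≤n
  Unique-allEqual⇒length≤1 {_ ∷ _ ∷ _} ((x≢y All.∷ _) ∷ _) equal =
    ⊥-elim (x≢y (equal (here refl) (there (here refl))))

  count≡sum-iverson : {P : A → Set} (P? : Decidable P) (xs : List A) →
                      count P? xs ≡ sum (map (iverson ∘ P?) xs)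
  count≡sum-iverson P? []       = refl
  count≡sum-iverson P? (x ∷ xs) with P? x
  ... | yes _ = cong suc (count≡sum-iverson P? xs)
  ... | no _  = count≡sum-iverson P? xs

  sum-map-1 : (xs : List A) → sum (map (λ _ → 1) xs) ≡ length xs
  sum-map-1 []       = refl
  sum-map-1 (_ ∷ xs) = cong suc (sum-map-1 xs)

  sum-map-+ : (f g : A → ℕ) (xs : List A) →
              sum (map (λ x → f x + g x) xs) ≡ sum (map f xs) + sum (map g xs)
  sum-map-+ f g []       = refl
  sum-map-+ f g (x ∷ xs) = trans (cong (f x + g x +_) (sum-map-+ f g xs)) (interchange (f x) (g x) _ _)
    where open CommutativeSemigroupProperties +-commutativeSemigroup using (interchange)

  sum-map-+-iverson : (f : A → ℕ) {P : A → Set} (P? : Decidable P) (xs : List A) →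
                      sum (map (λ x → f x + iverson (P? x)) xs) ≡ sum (map f xs) + count P? xs
  sum-map-+-iverson f P? xs =
    trans (sum-map-+ f (iverson ∘ P?) xs) (cong (sum (map f xs) +_) (sym (count≡sum-iverson P? xs)))

  sum-map-mono-≤ : {f g : A → ℕ} → (∀ x → f x ≤ g x) → (xs : List A) → sum (map f xs) ≤ sum (map g xs)
  sum-map-mono-≤ f≤g []       = z≤n
  sum-map-mono-≤ f≤g (x ∷ xs) = +-mono-≤ (f≤g x) (sum-map-mono-≤ f≤g xs)

sum-map-1-allFin : ∀ n → sum (map (λ _ → 1) (allFin n)) ≡ n
sum-map-1-allFin n = trans (sum-map-1 (allFin n)) (length-tabulate (λ i → i))

length-filter-map : {A B : Set} {P : B → Set} (P? : Decidable P) (f : A → B) (xs : List A) →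
                    length (filter P? (map f xs)) ≡ count (P? ∘ f) xs
length-filter-map P? f []       = refl
length-filter-map P? f (x ∷ xs) with does (P? (f x))
... | true  = cong suc (length-filter-map P? f xs)
... | false = length-filter-map P? f xs

module _ {A B : Set} where

  count-cartesianProduct : {P : A × B → Set} (P? : Decidable P) (xs : List A) (ys : List B) →
                           count P? (cartesianProduct xs ys) ≡
                           sum (map (λ x → count (λ y → P? (x , y)) ys) xs)
  count-cartesianProduct P? []       ys = refl
  count-cartesianProduct P? (x ∷ xs) ys = begin
    length (filter P? (map (x ,_) ys ++ cartesianProduct xs ys))
      ≡⟨ cong length (filter-++ P? (map (x ,_) ys) _) ⟩
    length (filter P? (map (x ,_) ys) ++ filter P? (cartesianProduct xs ys))
      ≡⟨ length-++ (filter P? (map (x ,_) ys)) ⟩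
    length (filter P? (map (x ,_) ys)) + count P? (cartesianProduct xs ys)
      ≡⟨ cong₂ _+_ (length-filter-map P? (x ,_) ys) (count-cartesianProduct P? xs ys) ⟩
    count (λ y → P? (x , y)) ys + sum (map (λ x → count (λ y → P? (x , y)) ys) xs) ∎
    where open Relation.Binary.PropositionalEquality.≡-Reasoning

module _ {A : Set} (_≟ᴬ_ : DecidableEquality A) where

  Unique-⊆⇒length≤ : {xs ys : List A} → Unique xs → xs ⊆ ys → length xs ≤ length ys
  Unique-⊆⇒length≤ {[]}     _              _        = z≤n
  Unique-⊆⇒length≤ {x ∷ xs} {ys} (x∉xs ∷ xs!) x∷xs⊆ys = begin-strict
    length xs               ≤⟨ Unique-⊆⇒length≤ xs! xs⊆ys-x ⟩
    count (¬? ∘ (_≟ᴬ x)) ys <⟨ filter-notAll (¬? ∘ (_≟ᴬ x)) ys x∈ys ⟩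
    length ys               ∎
    where
    open ≤-Reasoning
    x∈ys : Any.Any (λ y → ¬ (y ≢ x)) ys
    x∈ys = Any.map (λ x≡y y≢x → y≢x (sym x≡y)) (x∷xs⊆ys (here refl))
    xs⊆ys-x : xs ⊆ filter (¬? ∘ (_≟ᴬ x)) ys
    xs⊆ys-x z∈xs = ∈-filter⁺ (¬? ∘ (_≟ᴬ x)) (x∷xs⊆ys (there z∈xs)) (λ z≡x → All.lookup x∉xs z∈xs (sym z≡x))

  Unique∧∈⇒count-≟≡1 : {x : A} {xs : List A} → Unique xs → x ∈ xs → count (_≟ᴬ x) xs ≡ 1
  Unique∧∈⇒count-≟≡1 {x} {xs} xs! x∈xs = ≤-antisym
    (Unique-allEqual⇒length≤1 (filter⁺ (_≟ᴬ x) xs!) λ y∈ z∈ → trans (≡x y∈) (sym (≡x z∈)))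
    (Unique-⊆⇒length≤ (All.[] ∷ []) λ { (here refl) → ∈-filter⁺ (_≟ᴬ x) x∈xs refl })
    where
    ≡x : ∀ {y} → y ∈ filter (_≟ᴬ x) xs → y ≡ x
    ≡x = proj₂ ∘ ∈-filter⁻ (_≟ᴬ x) {xs = xs}

  module _ {P : A → Set} {k : ℕ} (card : HasCard P k) where

    private
      image : List A
      image = map (proj₁ card) (allFin k)

      length-image : length image ≡ k
      length-image = trans (length-map (proj₁ card) (allFin k)) (length-tabulate (λ i → i))

      Unique-image : Unique image
      Unique-image = map⁺ (proj₁ (proj₂ card)) (allFin⁺ k)

      ∈-image⁺ : ∀ {x} → P x → x ∈ image
      ∈-image⁺ {x} px with Equivalence.to (proj₂ (proj₂ card) x) px
      ... | i , refl = ∈-map⁺ (proj₁ card) (∈-allFin i)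

      ∈-image⁻ : ∀ {x} → x ∈ image → P x
      ∈-image⁻ {x} x∈ with ∈-map⁻ (proj₁ card) x∈
      ... | i , _ , refl = Equivalence.from (proj₂ (proj₂ card) x) (i , refl)

    HasCard⇒≤length : {ys : List A} → (∀ {x} → P x → x ∈ ys) → k ≤ length ys
    HasCard⇒≤length P⊆ys = subst (_≤ _) length-image (Unique-⊆⇒length≤ Unique-image (P⊆ys ∘ ∈-image⁻))

    length≤HasCard : {xs : List A} → Unique xs → (∀ {x} → x ∈ xs → P x) → length xs ≤ k
    length≤HasCard xs! xs⊆P = subst (_ ≤_) length-image (Unique-⊆⇒length≤ xs! (∈-image⁺ ∘ xs⊆P))

    HasCard⇒≡length : {xs : List A} → Unique xs → (∀ {x} → x ∈ xs → P x) → (∀ {x} → P x → x ∈ xs) →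
                      k ≡ length xs
    HasCard⇒≡length xs! xs⊆P P⊆xs = ≤-antisym (HasCard⇒≤length P⊆xs) (length≤HasCard xs! xs⊆P)

HasCard-swap : {A B : Set} {P : A × B → Set} {Q : B × A → Set} {k : ℕ} →
               (∀ a b → P (a , b) ⇔ Q (b , a)) → HasCard P k → HasCard Q k
HasCard-swap {Q = Q} P⇔Q (f , f-inj , P⇔image) = swap ∘ f , f-inj ∘ cong swap , Q⇔image
  where
  Q⇔image : ∀ x → Q x ⇔ ∃ λ i → swap (f i) ≡ x
  Q⇔image (b , a) = mk⇔
    (λ q → let i , fi≡ab = Equivalence.to (P⇔image (a , b)) (Equivalence.from (P⇔Q a b) q) in i , cong swap fi≡ab)
    (λ (i , swapfi≡ba) → Equivalence.to (P⇔Q a b) (Equivalence.from (P⇔image (a , b)) (i , cong swap swapfi≡ba)))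

HasCard-empty : {A : Set} {P : A → Set} {k : ℕ} → ¬ A → HasCard P k → k ≡ 0
HasCard-empty {k = 0}     _  _       = refl
HasCard-empty {k = suc _} ¬a (f , _) = ⊥-elim (¬a (f zero))

⋖-flip : ∀ {n} (R : Rel (Fin n) 0ℓ) {a b} → Poset._⋖_ (flip R) a b → Poset._⋖_ R b a
⋖-flip R ((b≼a , a≢b) , tight) =
  (b≼a , a≢b ∘ sym) ,
  λ c ((b≼c , b≢c) , (c≼a , c≢a)) → tight c ((c≼a , c≢a ∘ sym) , (b≼c , b≢c ∘ sym))

CoverEdge-flip : ∀ {n} (R : Rel (Fin n) 0ℓ) a b →
                 Poset.CoverEdge R (a , b) ⇔ Poset.CoverEdge (flip R) (b , a)
CoverEdge-flip R a b = mk⇔ (⋖-flip (flip R)) (⋖-flip R)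

module FinitePoset {n : ℕ} {_≼_ : Rel (Fin n) 0ℓ}
                   (isPartialOrder : IsPartialOrder _≡_ _≼_) (_≼?_ : ∀ a b → Dec (a ≼ b)) where

  open Poset _≼_ public
  open IsPartialOrder isPartialOrder using (antisym) renaming (refl to ≼-refl; trans to ≼-trans)

  _<?_ : ∀ a b → Dec (a < b)
  _<?_ = ToStrict.<-decidable _≡_ _≼_ _≟_ _≼?_

  _⋖?_ : ∀ a b → Dec (a ⋖ b)
  a ⋖? b = (a <? b) ×-dec all? (λ c → ¬? ((a <? c) ×-dec (c <? b)))

  <⇒⋡ : ∀ {a b} → a < b → ¬ (b ≼ a)
  <⇒⋡ = ToStrict.<⇒≱ _≡_ _≼_ antisym

  ⋖-tight : ∀ {a u x} → a ⋖ u → a < x → x ≼ u → x ≡ u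
  ⋖-tight {u = u} {x = x} (_ , tight) a<x x≼u with x ≟ u
  ... | yes x≡u = x≡u
  ... | no x≢u  = ⊥-elim (tight x (a<x , (x≼u , x≢u)))

  ∃⋖-below : ∀ {a b} → a < b → ∃ λ u → a ⋖ u × u ≼ b
  ∃⋖-below {a} = go (po-wellFounded isPartialOrder _)
    where
    go : ∀ {b} → Acc _<_ b → a < b → ∃ λ u → a ⋖ u × u ≼ b
    go {b} (acc below) a<b with any? (λ c → (a <? c) ×-dec (c <? b))
    ... | yes (c , a<c , c<b) =
      let u , a⋖u , u≼c = go (below c<b) a<c in u , a⋖u , ≼-trans u≼c (proj₁ c<b)
    ... | no ∄c               = b , (a<b , λ c a<c<b → ∄c (c , a<c<b)) , ≼-refl

  ≼⇒Connected : ∀ {a b} → a ≼ b → Connected a b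
  ≼⇒Connected {a} {b} = go (po-noetherian isPartialOrder a)
    where
    go : ∀ {a} → Acc (flip _<_) a → a ≼ b → Connected a b
    go {a} (acc above) a≼b with a ≟ b
    ... | yes refl = ε
    ... | no a≢b   =
      let u , a⋖u , u≼b = ∃⋖-below (a≼b , a≢b) in fwd a⋖u ◅ go (above (proj₁ a⋖u)) u≼b

  upperCovers : Fin n → List (Fin n)
  upperCovers a = filter (a ⋖?_) (allFin n)

  Σ#upperCovers : ℕ
  Σ#upperCovers = sum (map (length ∘ upperCovers) (allFin n))

  ⋖⇒1≤#upperCovers : ∀ {a u} → a ⋖ u → 1 ≤ length (upperCovers a)
  ⋖⇒1≤#upperCovers {a} {u} a⋖u =
    Unique-⊆⇒length≤ _≟_ (All.[] ∷ []) λ { (here refl) → ∈-filter⁺ (a ⋖?_) (∈-allFin u) a⋖u }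

  ⋖≢⇒2≤#upperCovers : ∀ {a u v} → a ⋖ u → a ⋖ v → u ≢ v → 2 ≤ length (upperCovers a)
  ⋖≢⇒2≤#upperCovers {a} {u} {v} a⋖u a⋖v u≢v = Unique-⊆⇒length≤ _≟_ ((u≢v All.∷ All.[]) ∷ All.[] ∷ [])
    λ { (here refl)         → ∈-filter⁺ (a ⋖?_) (∈-allFin u) a⋖u
      ; (there (here refl)) → ∈-filter⁺ (a ⋖?_) (∈-allFin v) a⋖v }

  ⋖-unique⇒#upperCovers≤1 : ∀ {a} → (∀ {u v} → a ⋖ u → a ⋖ v → u ≡ v) → length (upperCovers a) ≤ 1
  ⋖-unique⇒#upperCovers≤1 {a} unique =
    Unique-allEqual⇒length≤1 (filter⁺ (a ⋖?_) (allFin⁺ n)) λ u∈ v∈ → unique (covered u∈) (covered v∈)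
    where
    covered : ∀ {u} → u ∈ upperCovers a → a ⋖ u
    covered = proj₂ ∘ ∈-filter⁻ (a ⋖?_) {xs = allFin n}

  maximal⇒#upperCovers≡0 : ∀ {a} → (∀ u → ¬ a < u) → length (upperCovers a) ≡ 0
  maximal⇒#upperCovers≡0 {a} maximal =
    cong length (filter-none (a ⋖?_) {xs = allFin n} (All.tabulate λ {u} _ → maximal u ∘ proj₁))

  HasCard-CoverEdge⇒≡sum : ∀ {m} → HasCard CoverEdge m → m ≡ Σ#upperCovers
  HasCard-CoverEdge⇒≡sum edges = trans
    (HasCard⇒≡length (≡-dec _≟_ _≟_) edges (filter⁺ CoverEdge? (cartesianProduct⁺ (allFin⁺ n) (allFin⁺ n)))
      (proj₂ ∘ ∈-filter⁻ CoverEdge? {xs = cartesianProduct (allFin n) (allFin n)})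
      (λ {(a , b)} a⋖b → ∈-filter⁺ CoverEdge? (∈-cartesianProduct⁺ (∈-allFin a) (∈-allFin b)) a⋖b))
    (count-cartesianProduct CoverEdge? (allFin n) (allFin n))
    where
    CoverEdge? : Decidable CoverEdge
    CoverEdge? (a , b) = a ⋖? b

module _ {n : ℕ} {_≼_ : Rel (Fin (suc n)) 0ℓ} where
  open Poset _≼_

  connected⇒#ComponentRep≡1 : ∀ {c} → (∀ a b → Connected a b) → HasCard ComponentRep c → c ≡ 1
  connected⇒#ComponentRep≡1 connected reps = HasCard⇒≡length _≟_ reps (All.[] ∷ [])
    (λ { (here refl) _ _ → z≤n })
    (λ {a} rep → here (Fin.≤-antisym (rep zero (connected a zero)) z≤n))

module Reducibility {n : ℕ} (_∨_ _∧_ : Op₂ (Fin n)) where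
  open LatticeOps _∨_ _∧_

  JoinReducible? : Decidable JoinReducible
  JoinReducible? a = any? λ y → any? λ z → ¬? (y ≟ a) ×-dec (¬? (z ≟ a) ×-dec (a ≟ (y ∨ z)))

  MeetReducible? : Decidable MeetReducible
  MeetReducible? a = any? λ y → any? λ z → ¬? (y ≟ a) ×-dec (¬? (z ≟ a) ×-dec (a ≟ (y ∧ z)))

  #Reducible≤#JoinReducible+#MeetReducible : ∀ {r} → HasCard Reducible r →
    r ≤ count JoinReducible? (allFin n) + count MeetReducible? (allFin n)
  #Reducible≤#JoinReducible+#MeetReducible reducibles =
    subst (_ ≤_) (length-++ (filter JoinReducible? (allFin n)))
      (HasCard⇒≤length _≟_ reducibles λ
        { {a} (inj₁ a-red) → ∈-++⁺ˡ (∈-filter⁺ JoinReducible? (∈-allFin a) a-red)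
        ; {a} (inj₂ a-red) → ∈-++⁺ʳ (filter JoinReducible? (allFin n))
                                     (∈-filter⁺ MeetReducible? (∈-allFin a) a-red) })

module FiniteLattice {n : ℕ} {_≼_ : Rel (Fin n) 0ℓ} {_∨_ _∧_ : Op₂ (Fin n)}
                     (isLattice : IsLattice _≡_ _≼_ _∨_ _∧_) where

  lattice : Lattice 0ℓ 0ℓ 0ℓ
  lattice = record { isLattice = isLattice }

  open IsLattice isLattice
    using (isPartialOrder; antisym; x≤x∨y; y≤x∨y; x∧y≤x; x∧y≤y; ∧-greatest)
    renaming (refl to ≼-refl; trans to ≼-trans)
  open LatticeOps _∨_ _∧_ public
  open Reducibility _∨_ _∧_ public
  open JoinSemilatticeProperties (Lattice.joinSemilattice lattice) using (≈-dec⇒≤-dec)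
  open FinitePoset isPartialOrder (≈-dec⇒≤-dec _≟_) public

  dual : IsLattice _≡_ (flip _≼_) _∧_ _∨_
  dual = LatticeProperties.∧-∨-isLattice lattice

  connected : ∀ a b → Connected a b
  connected a b = transitive _⋖_ (≼⇒Connected (x≤x∨y a b)) (symmetric _⋖_ (≼⇒Connected (y≤x∨y a b)))

  top : Fin n → Fin n
  top a = foldr _∨_ a (allFin n)

  ≼-top : ∀ a b → b ≼ top a
  ≼-top a b = go (allFin n) (∈-allFin b)
    where
    go : ∀ {b} xs → b ∈ xs → b ≼ foldr _∨_ a xs
    go (_ ∷ _)  (here refl) = x≤x∨y _ _
    go (_ ∷ xs) (there b∈)  = ≼-trans (go xs b∈) (y≤x∨y _ _)

  MeetReducible⇒two⋖ : ∀ {a} → MeetReducible a → ∃₂ λ u v → a ⋖ u × a ⋖ v × u ≢ v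
  MeetReducible⇒two⋖ {a} (y , z , y≢a , z≢a , a≡y∧z) =
    let u , a⋖u , u≼y = ∃⋖-below (a≼ (x∧y≤x y z) , y≢a ∘ sym)
        v , a⋖v , v≼z = ∃⋖-below (a≼ (x∧y≤y y z) , z≢a ∘ sym)
    in u , v , a⋖u , a⋖v ,
       λ u≡v → <⇒⋡ (proj₁ a⋖u) (subst (u ≼_) (sym a≡y∧z) (∧-greatest u≼y (subst (_≼ z) (sym u≡v) v≼z)))
    where
    a≼ : ∀ {b} → (y ∧ z) ≼ b → a ≼ b
    a≼ = subst (_≼ _) (sym a≡y∧z)

  two⋖⇒MeetReducible : ∀ {a u v} → a ⋖ u → a ⋖ v → u ≢ v → MeetReducible a
  two⋖⇒MeetReducible {a} {u} {v} a⋖u a⋖v u≢v with a ≟ (u ∧ v)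
  ... | yes a≡u∧v = u , v , proj₂ (proj₁ a⋖u) ∘ sym , proj₂ (proj₁ a⋖v) ∘ sym , a≡u∧v
  ... | no a≢u∧v  =
    ⊥-elim (u≢v (trans (sym (⋖-tight a⋖u a<u∧v (x∧y≤x u v))) (⋖-tight a⋖v a<u∧v (x∧y≤y u v))))
    where
    a<u∧v : a < (u ∧ v)
    a<u∧v = ∧-greatest (proj₁ (proj₁ a⋖u)) (proj₁ (proj₁ a⋖v)) , a≢u∧v

  meetDecomposition⇒JoinReducible-∨ : ∀ {a y z} → y ≢ a → z ≢ a → a ≡ y ∧ z →
                                      JoinReducible (y ∨ z) × y ∨ z ≢ a
  meetDecomposition⇒JoinReducible-∨ {a} {y} {z} y≢a z≢a a≡y∧z = (y , z , y≢y∨z , z≢y∨z , refl) , y∨z≢a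
    where
    y∨z≢a : y ∨ z ≢ a
    y∨z≢a y∨z≡a = y≢a (antisym (subst (y ≼_) y∨z≡a (x≤x∨y y z)) (subst (_≼ y) (sym a≡y∧z) (x∧y≤x y z)))
    y≢y∨z : y ≢ y ∨ z
    y≢y∨z y≡y∨z = z≢a (sym (trans a≡y∧z
      (antisym (x∧y≤y y z) (∧-greatest (subst (z ≼_) (sym y≡y∨z) (y≤x∨y y z)) ≼-refl))))
    z≢y∨z : z ≢ y ∨ z
    z≢y∨z z≡y∨z = y≢a (sym (trans a≡y∧z
      (antisym (x∧y≤x y z) (∧-greatest ≼-refl (subst (y ≼_) (sym z≡y∨z) (x≤x∨y y z))))))

  module _ (⊤ : Fin n) (≼⊤ : ∀ a → a ≼ ⊤) where

    ⊤-meetIrreducible : ¬ MeetReducible ⊤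
    ⊤-meetIrreducible (y , z , y≢⊤ , _ , ⊤≡y∧z) = y≢⊤ (antisym (≼⊤ y) (subst (_≼ y) (sym ⊤≡y∧z) (x∧y≤x y z)))

    #upperCovers-lowerBound : ∀ a → 1 + iverson (MeetReducible? a) ≤ length (upperCovers a) + iverson (a ≟ ⊤)
    #upperCovers-lowerBound a with MeetReducible? a | a ≟ ⊤
    ... | yes a-red | yes refl = ⊥-elim (⊤-meetIrreducible a-red)
    ... | no _      | yes refl = m≤n+m 1 _
    ... | yes a-red | no _     = let _ , _ , a⋖u , a⋖v , u≢v = MeetReducible⇒two⋖ a-red in
                                 subst (2 ≤_) (sym (+-identityʳ _)) (⋖≢⇒2≤#upperCovers a⋖u a⋖v u≢v)
    ... | no _      | no a≢⊤   = let _ , a⋖u , _ = ∃⋖-below (≼⊤ a , a≢⊤) in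
                                 subst (1 ≤_) (sym (+-identityʳ _)) (⋖⇒1≤#upperCovers a⋖u)

    #upperCovers-upperBound : (∀ a → ¬ MeetReducible a) →
                              ∀ a → length (upperCovers a) + iverson (a ≟ ⊤) ≤ 1
    #upperCovers-upperBound irreducible a with a ≟ ⊤
    ... | yes refl = ≤-reflexive (cong (_+ 1) (maximal⇒#upperCovers≡0 λ u ⊤<u → <⇒⋡ ⊤<u (≼⊤ u)))
    ... | no _     = subst (_≤ 1) (sym (+-identityʳ _)) (⋖-unique⇒#upperCovers≤1 unique)
      where
      unique : ∀ {u v} → a ⋖ u → a ⋖ v → u ≡ v
      unique {u} {v} a⋖u a⋖v with u ≟ v
      ... | yes u≡v = u≡v
      ... | no u≢v  = ⊥-elim (irreducible a (two⋖⇒MeetReducible a⋖u a⋖v u≢v))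

    Σ[#upperCovers+iverson-≟⊤]≡Σ#upperCovers+1 :
      sum (map (λ a → length (upperCovers a) + iverson (a ≟ ⊤)) (allFin n)) ≡ Σ#upperCovers + 1
    Σ[#upperCovers+iverson-≟⊤]≡Σ#upperCovers+1 =
      trans (sum-map-+-iverson (length ∘ upperCovers) (_≟ ⊤) (allFin n))
            (cong (Σ#upperCovers +_) (Unique∧∈⇒count-≟≡1 _≟_ (allFin⁺ n) (∈-allFin ⊤)))

    n+#MeetReducible≤Σ#upperCovers+1 : n + count MeetReducible? (allFin n) ≤ Σ#upperCovers + 1
    n+#MeetReducible≤Σ#upperCovers+1 = begin
      n + count MeetReducible? (allFin n)
        ≡⟨ trans (sum-map-+-iverson (λ _ → 1) MeetReducible? (allFin n))
                 (cong (_+ count MeetReducible? (allFin n)) (sum-map-1-allFin n)) ⟨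
      sum (map (λ a → 1 + iverson (MeetReducible? a)) (allFin n))
        ≤⟨ sum-map-mono-≤ #upperCovers-lowerBound (allFin n) ⟩
      sum (map (λ a → length (upperCovers a) + iverson (a ≟ ⊤)) (allFin n))
        ≡⟨ Σ[#upperCovers+iverson-≟⊤]≡Σ#upperCovers+1 ⟩
      Σ#upperCovers + 1 ∎
      where open ≤-Reasoning

    noMeetReducible⇒Σ#upperCovers+1≤n : (∀ a → ¬ MeetReducible a) → Σ#upperCovers + 1 ≤ n
    noMeetReducible⇒Σ#upperCovers+1≤n irreducible = begin
      Σ#upperCovers + 1
        ≡⟨ Σ[#upperCovers+iverson-≟⊤]≡Σ#upperCovers+1 ⟨
      sum (map (λ a → length (upperCovers a) + iverson (a ≟ ⊤)) (allFin n))
        ≤⟨ sum-map-mono-≤ (#upperCovers-upperBound irreducible) (allFin n) ⟩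
      sum (map (λ _ → 1) (allFin n))
        ≡⟨ sum-map-1-allFin n ⟩
      n ∎
      where open ≤-Reasoning

    #MeetReducible≤nullity : ∀ {m k} → HasCard CoverEdge m → m + 1 ≡ n + k →
                             count MeetReducible? (allFin n) ≤ k
    #MeetReducible≤nullity {m} {k} edges m+1≡n+k = +-cancelˡ-≤ n _ k (begin
      n + count MeetReducible? (allFin n) ≤⟨ n+#MeetReducible≤Σ#upperCovers+1 ⟩
      Σ#upperCovers + 1                   ≡⟨ cong (_+ 1) (HasCard-CoverEdge⇒≡sum edges) ⟨
      m + 1                               ≡⟨ m+1≡n+k ⟩
      n + k                               ∎)
      where open ≤-Reasoning

    positiveNullity⇒∃MeetReducible : ∀ {m k} → HasCard CoverEdge m → m + 1 ≡ n + k → 1 ≤ k →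
                                     ∃ MeetReducible
    positiveNullity⇒∃MeetReducible {m} {k} edges m+1≡n+k 1≤k with any? MeetReducible?
    ... | yes a-red = a-red
    ... | no ∄a-red = ⊥-elim (<-irrefl refl (begin-strict
      n                 <⟨ m<m+n n 1≤k ⟩
      n + k             ≡⟨ m+1≡n+k ⟨
      m + 1             ≡⟨ cong (_+ 1) (HasCard-CoverEdge⇒≡sum edges) ⟩
      Σ#upperCovers + 1 ≤⟨ noMeetReducible⇒Σ#upperCovers+1≤n (λ a a-red → ∄a-red (a , a-red)) ⟩
      n                 ∎))
      where open ≤-Reasoning

  MeetReducible⇒2≤#Reducible : ∀ {r} → ∃ MeetReducible → HasCard Reducible r → 2 ≤ r
  MeetReducible⇒2≤#Reducible (a , y , z , y≢a , z≢a , a≡y∧z) reducibles =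
    length≤HasCard _≟_ reducibles ((a≢y∨z All.∷ All.[]) ∷ All.[] ∷ [])
      λ { (here refl) → inj₂ (y , z , y≢a , z≢a , a≡y∧z) ; (there (here refl)) → inj₁ y∨z-red }
    where
    y∨z-red : JoinReducible (y ∨ z)
    y∨z-red = proj₁ (meetDecomposition⇒JoinReducible-∨ y≢a z≢a a≡y∧z)
    a≢y∨z : a ≢ y ∨ z
    a≢y∨z = proj₂ (meetDecomposition⇒JoinReducible-∨ y≢a z≢a a≡y∧z) ∘ sym

HasNullity-Fin0⇒≡0 : ∀ {_≼_ : Rel (Fin 0) 0ℓ} {k} → Poset.HasNullity _≼_ k → k ≡ 0
HasNullity-Fin0⇒≡0 (m , c , edges , reps , m+c≡k) =
  trans (sym m+c≡k) (cong₂ _+_ (HasCard-empty (λ { (() , _) }) edges) (HasCard-empty (λ ()) reps))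

mainTheorem2 : (n : ℕ) (_≼_ : Rel (Fin n) 0ℓ) (_∨_ _∧_ : Fin n → Fin n → Fin n) →
    IsLattice _≡_ _≼_ _∨_ _∧_ →
    (k : ℕ) → 1 ≤ k → Poset.HasNullity _≼_ k →
    (r : ℕ) → HasCard (LatticeOps.Reducible _∨_ _∧_) r →
    2 ≤ r × r ≤ 2 * k
mainTheorem2 0 _ _ _ _ k 1≤k nullity _ _ with () ← subst (1 ≤_) (HasNullity-Fin0⇒≡0 nullity) 1≤k
mainTheorem2 (suc n) _≼_ _∨_ _∧_ isLattice k 1≤k (m , c , edges , reps , m+c≡n+k) r reducibles =
  L.MeetReducible⇒2≤#Reducible (L.positiveNullity⇒∃MeetReducible ⊤ ≼⊤ edges m+1≡n+k 1≤k) reducibles ,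
  (begin
    r          ≤⟨ L.#Reducible≤#JoinReducible+#MeetReducible reducibles ⟩
    count L.JoinReducible? (allFin (suc n)) + count L.MeetReducible? (allFin (suc n))
               ≤⟨ +-mono-≤ (D.#MeetReducible≤nullity ⊥ ⊥≼ dualEdges m+1≡n+k)
                           (L.#MeetReducible≤nullity ⊤ ≼⊤ edges m+1≡n+k) ⟩
    k + k      ≡⟨ cong (k +_) (+-identityʳ k) ⟨
    2 * k      ∎)
  where
  open ≤-Reasoning
  module L = FiniteLattice isLattice
  -- Reducibility of the dual lattice swaps the operations, so D.MeetReducible? is L.JoinReducible?.
  module D = FiniteLattice L.dual
  ⊤ ⊥ : Fin (suc n)
  ⊤ = L.top zero
  ⊥ = D.top zero
  ≼⊤ : ∀ a → a ≼ ⊤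
  ≼⊤ = L.≼-top zero
  ⊥≼ : ∀ a → ⊥ ≼ a
  ⊥≼ = D.≼-top zero
  m+1≡n+k : m + 1 ≡ suc n + k
  m+1≡n+k = subst (λ c → m + c ≡ suc n + k) (connected⇒#ComponentRep≡1 L.connected reps) m+c≡n+k
  dualEdges : HasCard D.CoverEdge m
  dualEdges = HasCard-swap (CoverEdge-flip _≼_) edges
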